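{- Let $D$ be a loose multipartite tournament of order $n$ with no sinks. If $S$ is an anti-$\{1,2\}$-competing set of $D$ that is not contained in any single partite set of $D$, then $|S|\le 4$. Moreover, if $|S|=4$, then: (1) there exist two partite sets $X_1,X_2$ of $D$ with $|S\cap X_1|=|S\cap X_2|=2$; (2) $n\ge 5$ and $C_{1,2}(D)$ is isomorphic to $K_n-E(K_4)$, the complete graph on $n$ vertices with the edges of a $4$-vertex clique removed.
   Context: All graphs and digraphs are finite and simple. For a digraph $D$, a sink is a vertex of outdegree $0$; $d_D(x,y)$ is the length of a shortest directed path from $x$ to $y$. The $(1,2)$-step competition graph $C_{1,2}(D)$ is the graph on $V(D)$ in which distinct $u,v$ are adjacent iff there is a vertex $w\notin\{u,v\}$ with either $d_{D-v}(u,w)\le 1$ and $d_{D-u}(v,w)\le 2$, or $d_{D-u}(v,w)\le 1$ and $d_{D-v}(u,w)\le 2$. A multipartite tournament is an orientation of a complete $k$-partite graph for some $k\ge3$ (with nonempty partite sets). A set of vertices is $\{1,2\}$-competing if it is a clique in $C_{1,2}(D)$, anti-$\{1,2\}$-competing if it is a stable set in $C_{1,2}(D)$. A multipartite tournament is loose if some partite set is not $\{1,2\}$-competing. -}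

module Defs where

open import Data.Nat using (ℕ; _≤_; _<_)
open import Data.Fin using (Fin; toℕ; _≟_)
open import Data.Fin.Subset using (Subset; _∈_; _∩_; ∣_∣)
open import Data.Vec using (tabulate)
open import Data.Product using (Σ; ∃; _×_; ∃-syntax)
open import Data.Sum using (_⊎_)
open import Data.Empty using (⊥)
open import Relation.Nullary using (¬_)
open import Relation.Nullary.Decidable using (does)
open import Relation.Binary.PropositionalEquality using (_≡_; _≢_)
open import Function.Bundles using (_↔_; Inverse)

-- A digraph on the vertex set Fin n: D u v means there is an arc u → v.
Digraph : ℕ → Set₁
Digraph n = Fin n → Fin n → Set

Graph : ℕ → Set₁
Graph n = Fin n → Fin n → Set

-- D is an orientation of the complete k-partite graph with partition `part`
-- (vertex v lies in partite set `part v`), k ≥ 3, all partite sets nonempty.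
record IsMultipartiteTournament {n : ℕ} (D : Digraph n) (k : ℕ) (part : Fin n → Fin k) : Set where
  field
    three≤k   : 3 ≤ k
    nonempty  : (i : Fin k) → ∃[ v ] part v ≡ i
    samePart  : (u v : Fin n) → part u ≡ part v → ¬ D u v
    diffPart  : (u v : Fin n) → part u ≢ part v → (D u v × ¬ D v u) ⊎ (D v u × ¬ D u v)

IsSink : {n : ℕ} → Digraph n → Fin n → Set
IsSink D v = ∀ w → ¬ D v w

-- d_{D - a}(v, w) ≤ 2 for distinct v, w both different from a
-- (a directed path of length 1 or 2 from v to w avoiding a).
Reach≤2Avoiding : {n : ℕ} → Digraph n → (a v w : Fin n) → Set
Reach≤2Avoiding D a v w = D v w ⊎ (∃[ x ] (x ≢ a × D v x × D x w))

-- adjacency in the (1,2)-step competition graph C_{1,2}(D).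
-- Since w ∉ {u,v} and D is loopless, d_{D-v}(u,w) ≤ 1 means exactly D u w.
C12 : {n : ℕ} → Digraph n → Graph n
C12 D u v = u ≢ v × ∃[ w ] (w ≢ u × w ≢ v ×
              ((D u w × Reach≤2Avoiding D u v w) ⊎ (D v w × Reach≤2Avoiding D v u w)))

IsClique : {n : ℕ} → Graph n → (Fin n → Set) → Set
IsClique G S = ∀ u v → S u → S v → u ≢ v → G u v

IsStable : {n : ℕ} → Graph n → (Fin n → Set) → Set
IsStable G S = ∀ u v → S u → S v → ¬ G u v

InPart : {n k : ℕ} → (Fin n → Fin k) → Fin k → Fin n → Set
InPart part i v = part v ≡ i

partSet : {n k : ℕ} → (Fin n → Fin k) → Fin k → Subset n
partSet part i = tabulate (λ v → does (part v ≟ i))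

Competing12 : {n : ℕ} → Digraph n → (Fin n → Set) → Set
Competing12 D S = IsClique (C12 D) S

AntiCompeting12 : {n : ℕ} → Digraph n → (Fin n → Set) → Set
AntiCompeting12 D S = IsStable (C12 D) S

Loose : {n k : ℕ} → Digraph n → (Fin n → Fin k) → Set
Loose D part = ∃[ i ] ¬ Competing12 D (InPart part i)

KnMinusK4 : (n : ℕ) → Graph n
KnMinusK4 n u v = u ≢ v × ¬ (toℕ u < 4 × toℕ v < 4)

_≅G_ : {n m : ℕ} → Graph n → Graph m → Set
_≅G_ {n} {m} G H = Σ (Fin n ↔ Fin m) λ f →
  ∀ u v → (G u v → H (Inverse.to f u) (Inverse.to f v)) × (H (Inverse.to f u) (Inverse.to f v) → G u v)

-- Stability of S in C₁,₂(D) means that no two vertices of S have a common out-neighbour and, since D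
-- has no sinks, that no vertex of S has two out-neighbours in S.  So for an arc u → v inside S, every
-- vertex of S is u, v, the in-neighbour p of u or the out-neighbour q of v, and ∣S∣ ≤ 4.  If ∣S∣ = 4,
-- then u → v → q → p → u is a 4-cycle alternating between two partite sets.  Each vertex s of such a
-- cycle returns to its own partite set along s → s′ → s″, which forces s′ to be the only out-neighbour
-- of s; hence every vertex outside S dominates all cycle vertices of other partite sets.  This gives
-- every pair not inside S a common out-neighbour, or an out-neighbour that the other vertex reaches in
-- two steps, so C₁,₂(D) is Kₙ with the clique on S removed.

module Submission where

open import Defs
open import Data.Nat using (ℕ; suc; _≤_; _<_; z≤n; s≤s; s≤s⁻¹)
open import Data.Nat.Properties using (≤-refl; ≤-trans; ≤-reflexive; n≤1+n; ≤-antisym; ≤⇒≯)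
open import Data.Fin using (Fin; zero; suc; toℕ; fromℕ; fromℕ<; _≟_; punchIn)
open import Data.Fin.Properties using (toℕ-fromℕ; any?; ¬∀⟶∃¬)
open import Data.Fin.Subset using (Subset; _∈_; _∉_; _∩_; _-_; ∣_∣; ⊤; inside; outside) renaming (⊥ to ∅)
open import Data.Fin.Subset.Properties
  using (_∈?_; p⊆q⇒∣p∣≤∣q∣; p⊂q⇒∣p∣<∣q∣; Empty-unique; ∣⊥∣≡0; ∣⊤∣≡n; ∣p∣≤n; ∈⊤; drop-there;
         x∈p∧x≢y⇒x∈p-y; x∈p⇒∣p-x∣<∣p∣; p─q⊆p; x∈p∩q⁺; x∈p∩q⁻)
open import Data.Fin.Permutation using (Permutation′; _⟨$⟩ʳ_; id; lift₀; insert; insert-punchIn)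
open import Data.Vec using (_∷_; []; here; there; tail)
open import Data.Vec.Properties using (lookup∘tabulate; []=⇒lookup; lookup⇒[]=)
open import Data.List using (List; []; _∷_; length)
open import Data.List.Membership.Propositional using () renaming (_∈_ to _∈ₗ_)
open import Data.List.Membership.Propositional.Properties using (∉[])
import Data.List.Relation.Unary.Any as Any
open import Data.List.Relation.Unary.All using (All; []; _∷_)
import Data.List.Relation.Unary.All as All
open import Data.List.Relation.Unary.AllPairs using ([]; _∷_)
open import Data.List.Relation.Unary.Unique.Propositional using (Unique)
open import Data.Product using (Σ; ∃-syntax; _×_; _,_; proj₁; proj₂; uncurry)
open import Data.Product.Function.NonDependent.Propositional using (_×-⇔_)
open import Data.Sum using (_⊎_; inj₁; inj₂; [_,_]′)
import Data.Sum as Sum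
open import Data.Empty using (⊥; ⊥-elim)
open import Data.Bool using (true)
open import Function using (_∘_)
open import Function.Bundles using (_⇔_; mk⇔; Equivalence; Injection)
open import Function.Properties.Inverse using (↔⇒↣)
open import Level using (Level)
open import Relation.Nullary using (¬_; Dec; does; yes; no)
open import Relation.Nullary.Decidable using (decidable-stable; dec-true; toSum; _×-dec_; ¬?)
open import Relation.Unary using (Pred; Decidable)
open import Relation.Binary.PropositionalEquality
  using (_≡_; _≢_; refl; sym; trans; subst; subst₂; cong; module ≡-Reasoning)

private
  variable
    ℓ : Level
    n k : ℕ

infix 4 _⊆ₗ_

_⊆ₗ_ : Subset n → List (Fin n) → Set
p ⊆ₗ xs = ∀ {y} → y ∈ p → y ∈ₗ xs

x∉p-x : (p : Subset n) (x : Fin n) → x ∉ p - x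
x∉p-x (_ ∷ p) (suc x) (there x∈p-x) = x∉p-x p x x∈p-x

∣p∣≤1+∣p-x∣ : (p : Subset n) (x : Fin n) → ∣ p ∣ ≤ suc ∣ p - x ∣
-- The tail of (b ∷ p) - zero is not syntactically p ─ ⊥, so p─⊥≡p does not apply; compare by membership.
∣p∣≤1+∣p-x∣ (b ∷ p) zero = ≤-trans (∣b∷p∣≤1+∣p∣ b) (s≤s (p⊆q⇒∣p∣≤∣q∣ p⊆tail))
  where
  ∣b∷p∣≤1+∣p∣ : ∀ b → ∣ b ∷ p ∣ ≤ suc ∣ p ∣
  ∣b∷p∣≤1+∣p∣ inside  = ≤-refl
  ∣b∷p∣≤1+∣p∣ outside = n≤1+n _

  p⊆tail : ∀ {y} → y ∈ p → y ∈ tail ((b ∷ p) - zero)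
  p⊆tail y∈p = drop-there (x∈p∧x≢y⇒x∈p-y {p = b ∷ p} {y = zero} (there y∈p) λ ())
∣p∣≤1+∣p-x∣ (inside  ∷ p) (suc x) = s≤s (∣p∣≤1+∣p-x∣ p x)
∣p∣≤1+∣p-x∣ (outside ∷ p) (suc x) = ∣p∣≤1+∣p-x∣ p x

⊆ₗ-uncons : {p : Subset n} {x : Fin n} {xs : List (Fin n)} →
            p ⊆ₗ (x ∷ xs) → (∀ {y} → y ∈ p → y ≡ x → y ∈ₗ xs) → p ⊆ₗ xs
⊆ₗ-uncons p⊆x∷xs at-x y∈p with p⊆x∷xs y∈p
... | Any.here y≡x   = at-x y∈p y≡x
... | Any.there y∈xs = y∈xs

∣p∣≤length : (p : Subset n) (xs : List (Fin n)) → p ⊆ₗ xs → ∣ p ∣ ≤ length xs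
∣p∣≤length {n} p [] p⊆[] = ≤-reflexive (begin
  ∣ p ∣         ≡⟨ cong ∣_∣ (Empty-unique {p = p} (λ (_ , y∈p) → ∉[] (p⊆[] y∈p))) ⟩
  ∣ ∅ {n = n} ∣ ≡⟨ ∣⊥∣≡0 n ⟩
  0             ∎)
  where open ≡-Reasoning
∣p∣≤length p (x ∷ xs) p⊆x∷xs = ≤-trans (∣p∣≤1+∣p-x∣ p x) (s≤s (∣p∣≤length (p - x) xs p-x⊆xs))
  where
  p-x⊆xs : (p - x) ⊆ₗ xs
  p-x⊆xs = ⊆ₗ-uncons (p⊆x∷xs ∘ p─q⊆p p _) (λ { y∈p-x refl → ⊥-elim (x∉p-x p x y∈p-x) })

length≤∣p∣ : (p : Subset n) (xs : List (Fin n)) → Unique xs → All (_∈ p) xs → length xs ≤ ∣ p ∣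
length≤∣p∣ p []       _                _              = z≤n
length≤∣p∣ p (x ∷ xs) (x∉xs ∷ xs-uniq) (x∈p ∷ xs⊆p) =
  ≤-trans (s≤s (length≤∣p∣ (p - x) xs xs-uniq (All.zipWith xs⊆p-x (xs⊆p , x∉xs)))) (x∈p⇒∣p-x∣<∣p∣ x∈p)
  where
  xs⊆p-x : ∀ {y} → y ∈ p × x ≢ y → y ∈ p - x
  xs⊆p-x (y∈p , x≢y) = x∈p∧x≢y⇒x∈p-y y∈p (x≢y ∘ sym)

∣p∣≡length : (p : Subset n) (xs : List (Fin n)) → Unique xs → (∀ y → y ∈ p ⇔ y ∈ₗ xs) → ∣ p ∣ ≡ length xs
∣p∣≡length p xs xs-uniq p⇔xs = ≤-antisym
  (∣p∣≤length p xs (Equivalence.to (p⇔xs _)))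
  (length≤∣p∣ p xs xs-uniq (All.tabulate (Equivalence.from (p⇔xs _))))

tight-cover⇒distinct-members : (p : Subset n) (xs : List (Fin n)) → p ⊆ₗ xs → ∣ p ∣ ≡ length xs →
                               Unique xs × All (_∈ p) xs
tight-cover⇒distinct-members p []       _       _    = [] , []
tight-cover⇒distinct-members p (x ∷ xs) p⊆x∷xs ∣p∣≡ =
  (x∉xs ∷ proj₁ ih) , (x∈p ∷ All.map (p─q⊆p p _) (proj₂ ih))
  where
  too-small : p ⊆ₗ xs → ⊥
  too-small p⊆xs = ≤⇒≯ (∣p∣≤length p xs p⊆xs) (≤-reflexive (sym ∣p∣≡))

  x∈p : x ∈ p
  x∈p = decidable-stable (x ∈? p) λ x∉p → too-small (⊆ₗ-uncons p⊆x∷xs λ { y∈p refl → ⊥-elim (x∉p y∈p) })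

  x∉xs : All (x ≢_) xs
  x∉xs = All.tabulate λ { x∈xs refl → too-small (⊆ₗ-uncons p⊆x∷xs λ { _ refl → x∈xs }) }

  p-x⊆xs : (p - x) ⊆ₗ xs
  p-x⊆xs = ⊆ₗ-uncons (p⊆x∷xs ∘ p─q⊆p p _) (λ { y∈p-x refl → ⊥-elim (x∉p-x p x y∈p-x) })

  ∣p-x∣≡ : ∣ p - x ∣ ≡ length xs
  ∣p-x∣≡ = ≤-antisym (∣p∣≤length (p - x) xs p-x⊆xs) (s≤s⁻¹ (subst (_≤ suc ∣ p - x ∣) ∣p∣≡ (∣p∣≤1+∣p-x∣ p x)))

  ih : Unique xs × All (_∈ p - x) xs
  ih = tight-cover⇒distinct-members (p - x) xs p-x⊆xs ∣p-x∣≡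

toℕ-punchIn-fromℕ : (i : Fin n) → toℕ (punchIn (fromℕ n) i) ≡ toℕ i
toℕ-punchIn-fromℕ zero    = refl
toℕ-punchIn-fromℕ (suc i) = cong suc (toℕ-punchIn-fromℕ i)

∃-permutation-to-front : (p : Subset n) → Σ (Permutation′ n) λ σ → ∀ x → x ∈ p ⇔ toℕ (σ ⟨$⟩ʳ x) < ∣ p ∣
∃-permutation-to-front []      = id , λ ()
∃-permutation-to-front (inside ∷ p) with ∃-permutation-to-front p
... | σ , σ-front = lift₀ σ , λ
  { zero    → mk⇔ (λ _ → s≤s z≤n) (λ _ → here)
  ; (suc x) → mk⇔ (s≤s ∘ Equivalence.to (σ-front x) ∘ drop-there)
                  (there ∘ Equivalence.from (σ-front x) ∘ s≤s⁻¹)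
  }
∃-permutation-to-front {suc n} (outside ∷ p) with ∃-permutation-to-front p
... | σ , σ-front = τ , λ
  { zero    → mk⇔ (λ ()) λ n<∣p∣ → ⊥-elim (≤⇒≯ (∣p∣≤n p) (subst (_< ∣ p ∣) (toℕ-fromℕ n) n<∣p∣))
  ; (suc x) → mk⇔ (subst (_< ∣ p ∣) (sym (τ-suc x)) ∘ Equivalence.to (σ-front x) ∘ drop-there)
                  (there ∘ Equivalence.from (σ-front x) ∘ subst (_< ∣ p ∣) (τ-suc x))
  }
  where
  τ : Permutation′ (suc n)
  τ = insert zero (fromℕ n) σ

  τ-suc : ∀ x → toℕ (τ ⟨$⟩ʳ suc x) ≡ toℕ (σ ⟨$⟩ʳ x)
  τ-suc x = trans (cong toℕ (insert-punchIn zero (fromℕ n) σ x)) (toℕ-punchIn-fromℕ (σ ⟨$⟩ʳ x))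

at-most-one⇒∃-cover : {P : Pred (Fin n) ℓ} → Decidable P → (∀ {x y} → P x → P y → x ≡ y) →
                      Fin n → ∃[ c ] (∀ {y} → P y → y ≡ c)
at-most-one⇒∃-cover P? at-most-one default with any? P?
... | yes (c , Pc) = c , λ Py → at-most-one Py Pc
... | no  ∄P       = default , λ Py → ⊥-elim (∄P (_ , Py))

∃-avoiding₂ : 3 ≤ k → (i j : Fin k) → ∃[ t ] (t ≢ i × t ≢ j)
∃-avoiding₂ {k} 3≤k i j =
  let (t , t∉ij) = ¬∀⟶∃¬ k (_∈ₗ i ∷ j ∷ []) (λ t → Any.any? (t ≟_) (i ∷ j ∷ [])) ¬all
  in t , t∉ij ∘ Any.here , t∉ij ∘ Any.there ∘ Any.here
  where
  ¬all : ¬ (∀ t → t ∈ₗ i ∷ j ∷ [])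
  ¬all all = ≤⇒≯ (subst (_≤ 2) (∣⊤∣≡n k) (∣p∣≤length ⊤ (i ∷ j ∷ []) (λ {t} _ → all t))) 3≤k

does≡true⇒ : {A : Set ℓ} (a? : Dec A) → does a? ≡ true → A
does≡true⇒ (yes a) _ = a

∈partSet⇔ : {part : Fin n → Fin k} {i : Fin k} {y : Fin n} → y ∈ partSet part i ⇔ part y ≡ i
∈partSet⇔ {part = part} {i} {y} = mk⇔
  (does≡true⇒ (part y ≟ i) ∘ trans (sym (lookup∘tabulate _ y)) ∘ []=⇒lookup)
  (lookup⇒[]= y _ ∘ trans (lookup∘tabulate _ y) ∘ dec-true (part y ≟ i))

∈∩partSet⇔ : {S : Subset n} {part : Fin n → Fin k} {i : Fin k} {y : Fin n} →
             y ∈ S ∩ partSet part i ⇔ (y ∈ S × part y ≡ i)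
∈∩partSet⇔ {S = S} {part} = mk⇔
  (λ y∈ → let (y∈S , y∈Xᵢ) = x∈p∩q⁻ S _ y∈ in y∈S , Equivalence.to (∈partSet⇔ {part = part}) y∈Xᵢ)
  (λ (y∈S , py≡i) → x∈p∩q⁺ (y∈S , Equivalence.from (∈partSet⇔ {part = part}) py≡i))

∣S∩partSet∣≡2 : {S : Subset n} {part : Fin n → Fin k} {a c : Fin n} → a ∈ S → c ∈ S → a ≢ c → part c ≡ part a →
                (∀ {y} → y ∈ S → part y ≡ part a → y ≡ a ⊎ y ≡ c) → ∣ S ∩ partSet part (part a) ∣ ≡ 2
∣S∩partSet∣≡2 {S = S} {part} {a} {c} a∈S c∈S a≢c pc≡pa in-part-of-a =
  ∣p∣≡length (S ∩ partSet part (part a)) (a ∷ c ∷ []) ((a≢c ∷ []) ∷ [] ∷ []) λ y → mk⇔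
    (∈[a,c] ∘ uncurry in-part-of-a ∘ Equivalence.to y∈S∩Xₐ⇔)
    (Equivalence.from y∈S∩Xₐ⇔ ∘ λ { (Any.here refl) → a∈S , refl ; (Any.there (Any.here refl)) → c∈S , pc≡pa })
  where
  y∈S∩Xₐ⇔ : ∀ {y} → y ∈ S ∩ partSet part (part a) ⇔ (y ∈ S × part y ≡ part a)
  y∈S∩Xₐ⇔ = ∈∩partSet⇔ {part = part}

  ∈[a,c] : ∀ {y} → y ≡ a ⊎ y ≡ c → y ∈ₗ a ∷ c ∷ []
  ∈[a,c] (inj₁ y≡a) = Any.here y≡a
  ∈[a,c] (inj₂ y≡c) = Any.there (Any.here y≡c)

crossing-pair : {S : Subset n} {part : Fin n → Fin k} → Fin k → ¬ (∃[ i ] ∀ v → v ∈ S → part v ≡ i) →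
                ∃[ u ] ∃[ w ] (u ∈ S × w ∈ S × part u ≢ part w)
crossing-pair {S = S} {part} i₀ ¬in-one-part with any? (_∈? S)
... | no ∄u = ⊥-elim (¬in-one-part (i₀ , λ v v∈S → ⊥-elim (∄u (v , v∈S))))
... | yes (u , u∈S) with any? (λ w → w ∈? S ×-dec ¬? (part u ≟ part w))
...   | yes (w , w∈S , pu≢pw) = u , w , u∈S , w∈S , pu≢pw
...   | no ∄w = ⊥-elim (¬in-one-part (part u , λ v v∈S →
          decidable-stable (part v ≟ part u) λ pv≢pu → ∄w (v , v∈S , pv≢pu ∘ sym)))

≅KnMinusK4 : (G : Graph n) (P : Subset n) → ∣ P ∣ ≡ 4 →
             (∀ x y → G x y ⇔ (x ≢ y × ¬ (x ∈ P × y ∈ P))) → G ≅G KnMinusK4 n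
≅KnMinusK4 {n} G P ∣P∣≡4 G⇔ with ∃-permutation-to-front P
... | σ , σ-front = σ , λ x y → to x y , from x y
  where
  both∈P⇔ : ∀ x y → (x ∈ P × y ∈ P) ⇔ (toℕ (σ ⟨$⟩ʳ x) < 4 × toℕ (σ ⟨$⟩ʳ y) < 4)
  both∈P⇔ x y = subst (λ m → (x ∈ P × y ∈ P) ⇔ (toℕ (σ ⟨$⟩ʳ x) < m × toℕ (σ ⟨$⟩ʳ y) < m)) ∣P∣≡4
                  (σ-front x ×-⇔ σ-front y)

  to : ∀ x y → G x y → KnMinusK4 n (σ ⟨$⟩ʳ x) (σ ⟨$⟩ʳ y)
  to x y Gxy = let (x≢y , ¬both) = Equivalence.to (G⇔ x y) Gxy
               in x≢y ∘ Injection.injective (↔⇒↣ σ) , ¬both ∘ Equivalence.from (both∈P⇔ x y)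

  from : ∀ x y → KnMinusK4 n (σ ⟨$⟩ʳ x) (σ ⟨$⟩ʳ y) → G x y
  from x y (σx≢σy , ¬both) =
    Equivalence.from (G⇔ x y) (σx≢σy ∘ cong (σ ⟨$⟩ʳ_) , ¬both ∘ Equivalence.to (both∈P⇔ x y))

C12-sym : {D : Digraph n} {x y : Fin n} → C12 D x y → C12 D y x
C12-sym (x≢y , w , w≢x , w≢y , inj₁ via-x) = x≢y ∘ sym , w , w≢y , w≢x , inj₂ via-x
C12-sym (x≢y , w , w≢x , w≢y , inj₂ via-y) = x≢y ∘ sym , w , w≢y , w≢x , inj₁ via-y

module MultipartiteTournament {D : Digraph n} {part : Fin n → Fin k}
                              (mt : IsMultipartiteTournament D k part) where
  open IsMultipartiteTournament mt

  private
    variable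
      s x y z w : Fin n

  arc⇒part≢ : D x y → part x ≢ part y
  arc⇒part≢ x→y px≡py = samePart _ _ px≡py x→y

  arc⇒≢ : D x y → x ≢ y
  arc⇒≢ x→y refl = arc⇒part≢ x→y refl

  arc-asym : D x y → ¬ D y x
  arc-asym {x} {y} x→y with diffPart x y (arc⇒part≢ x→y)
  ... | inj₁ (_ , ¬y→x) = ¬y→x
  ... | inj₂ (_ , ¬x→y) = ⊥-elim (¬x→y x→y)

  arc-or-arc : part x ≢ part y → D x y ⊎ D y x
  arc-or-arc {x} {y} px≢py with diffPart x y px≢py
  ... | inj₁ (x→y , _) = inj₁ x→y
  ... | inj₂ (y→x , _) = inj₂ y→x

  crossing-arc : {S : Subset n} → ¬ (∃[ i ] ∀ v → v ∈ S → part v ≡ i) → ∃[ u ] ∃[ v ] (u ∈ S × v ∈ S × D u v)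
  crossing-arc ¬in-one-part with crossing-pair (fromℕ< (≤-trans (s≤s z≤n) three≤k)) ¬in-one-part
  ... | u , w , u∈S , w∈S , pu≢pw with arc-or-arc pu≢pw
  ...   | inj₁ u→w = u , w , u∈S , w∈S , u→w
  ...   | inj₂ w→u = w , u , w∈S , u∈S , w→u

  C12-common-out : x ≢ y → D x w → D y w → C12 D x y
  C12-common-out x≢y x→w y→w = x≢y , _ , arc⇒≢ x→w ∘ sym , arc⇒≢ y→w ∘ sym , inj₁ (x→w , inj₁ y→w)

  C12-out-and-2-path : x ≢ y → D x w → D y z → D z w → z ≢ x → w ≢ y → C12 D x y
  C12-out-and-2-path x≢y x→w y→z z→w z≢x w≢y =
    x≢y , _ , arc⇒≢ x→w ∘ sym , w≢y , inj₁ (x→w , inj₂ (_ , z≢x , y→z , z→w))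

  record IsAlternating4Cycle (a b c d : Fin n) : Set where
    field
      a→b    : D a b
      b→c    : D b c
      c→d    : D c d
      d→a    : D d a
      part-c : part c ≡ part a
      part-d : part d ≡ part b

  module StableSet {S : Subset n} (stable : AntiCompeting12 D (_∈ S)) where

    ∉∧∈⇒≢ : z ∉ S → s ∈ S → z ≢ s
    ∉∧∈⇒≢ z∉S s∈S refl = z∉S s∈S

    no-common-out-neighbour : x ∈ S → y ∈ S → x ≢ y → D x w → ¬ D y w
    no-common-out-neighbour x∈S y∈S x≢y x→w y→w = stable _ _ x∈S y∈S (C12-common-out x≢y x→w y→w)

    in-neighbour-unique : x ∈ S → y ∈ S → D x w → D y w → x ≡ y
    in-neighbour-unique {x} {y} x∈S y∈S x→w y→w =
      decidable-stable (x ≟ y) λ x≢y → no-common-out-neighbour x∈S y∈S x≢y x→w y→w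

    out-neighbour-unique : (∀ v → ¬ IsSink D v) → x ∈ S → y ∈ S → z ∈ S → D x y → D x z → y ≡ z
    out-neighbour-unique {x} {y} {z} no-sink x∈S y∈S z∈S x→y x→z with y ≟ z
    ... | yes y≡z = y≡z
    ... | no y≢z with part y ≟ part z
    ...   | no py≢pz = ⊥-elim ([ no-common-out-neighbour x∈S y∈S (arc⇒≢ x→y) x→z
                              , no-common-out-neighbour x∈S z∈S (arc⇒≢ x→z) x→y ]′ (arc-or-arc py≢pz))
    ...   | yes py≡pz = ⊥-elim (no-sink y y-is-sink)
      where
      -- An out-neighbour w of y either beats z, giving x → z and y → w → z, or is beaten by z.
      y-is-sink : IsSink D y
      y-is-sink w y→w with arc-or-arc {w} {z} (λ pw≡pz → arc⇒part≢ y→w (trans py≡pz (sym pw≡pz)))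
      ... | inj₁ w→z = stable _ _ x∈S y∈S
              (C12-out-and-2-path (arc⇒≢ x→y) x→z y→w w→z (λ { refl → arc-asym x→y y→w }) (y≢z ∘ sym))
      ... | inj₂ z→w = no-common-out-neighbour y∈S z∈S y≢z y→w z→w

    sole-out-neighbour : x ∈ S → y ∈ S → w ∈ S → x ≢ w → D x y → D y w → part w ≡ part x → D x z → z ≡ y
    sole-out-neighbour {x} {y} {w} {z} x∈S y∈S w∈S x≢w x→y y→w pw≡px x→z with z ≟ y
    ... | yes z≡y = z≡y
    ... | no z≢y with arc-or-arc {z} {w} (λ pz≡pw → arc⇒part≢ x→z (sym (trans pz≡pw pw≡px)))
    ...   | inj₁ z→w = ⊥-elim (stable _ _ y∈S x∈S
              (C12-out-and-2-path (arc⇒≢ x→y ∘ sym) y→w x→z z→w z≢y (x≢w ∘ sym)))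
    ...   | inj₂ w→z = ⊥-elim (no-common-out-neighbour x∈S w∈S x≢w x→z w→z)

    record ReturnPath (s : Fin n) : Set where
      constructor return-path
      field
        {next next²} : Fin n
        next∈S       : next ∈ S
        next²∈S      : next² ∈ S
        s≢next²      : s ≢ next²
        s→next       : D s next
        next→next²   : D next next²
        part-next²   : part next² ≡ part s

    module Returning (returns : ∀ {s} → s ∈ S → ReturnPath s) where

      outside⇒arc : s ∈ S → z ∉ S → part z ≢ part s → D z s
      outside⇒arc s∈S z∉S pz≢ps with arc-or-arc pz≢ps
      ... | inj₁ z→s = z→s
      ... | inj₂ s→z = ⊥-elim (∉∧∈⇒≢ z∉S next∈S
              (sole-out-neighbour s∈S next∈S next²∈S s≢next² s→next next→next² part-next² s→z))
        where open ReturnPath (returns s∈S)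

      module _ {s} (s∈S : s ∈ S) where
        open ReturnPath (returns s∈S)

        part-next≢ : part next ≢ part s
        part-next≢ = arc⇒part≢ s→next ∘ sym

        outside⇒arc-next : z ∉ S → part z ≡ part s → D z next
        outside⇒arc-next z∉S pz≡ps = outside⇒arc next∈S z∉S λ pz≡pn → part-next≢ (trans (sym pz≡pn) pz≡ps)

        outside⇒arc-next² : z ∉ S → part z ≡ part next → D z next²
        outside⇒arc-next² z∉S pz≡pn =
          outside⇒arc next²∈S z∉S λ pz≡pn² → part-next≢ (trans (sym pz≡pn) (trans pz≡pn² part-next²))

        C12-outside-inside : z ∉ S → C12 D z s
        C12-outside-inside {z} z∉S with part z ≟ part next
        ... | no pz≢pn = C12-common-out (∉∧∈⇒≢ z∉S s∈S) (outside⇒arc next∈S z∉S pz≢pn) s→next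
        ... | yes pz≡pn = C12-out-and-2-path (∉∧∈⇒≢ z∉S s∈S) (outside⇒arc-next² z∉S pz≡pn) s→next next→next²
                            (∉∧∈⇒≢ z∉S next∈S ∘ sym) (s≢next² ∘ sym)

        C12-outside-across : z ∉ S → y ∉ S → z ≢ y → part z ≡ part s → part y ≢ part s → C12 D z y
        C12-outside-across {z} {y} z∉S y∉S z≢y pz≡ps py≢ps with part y ≟ part next
        ... | no py≢pn  = C12-common-out z≢y (outside⇒arc-next z∉S pz≡ps) (outside⇒arc next∈S y∉S py≢pn)
        ... | yes py≡pn = C12-sym (C12-out-and-2-path (z≢y ∘ sym) (outside⇒arc-next² y∉S py≡pn)
                            (outside⇒arc-next z∉S pz≡ps) next→next²
                            (∉∧∈⇒≢ y∉S next∈S ∘ sym) (∉∧∈⇒≢ z∉S next²∈S ∘ sym))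

        C12-outside-outside : z ∉ S → y ∉ S → z ≢ y → C12 D z y
        C12-outside-outside {z} {y} z∉S y∉S z≢y with part z ≟ part s | part y ≟ part s
        ... | no pz≢ps  | no py≢ps  =
          C12-common-out z≢y (outside⇒arc s∈S z∉S pz≢ps) (outside⇒arc s∈S y∉S py≢ps)
        ... | yes pz≡ps | yes py≡ps =
          C12-common-out z≢y (outside⇒arc-next z∉S pz≡ps) (outside⇒arc-next y∉S py≡ps)
        ... | yes pz≡ps | no py≢ps  = C12-outside-across z∉S y∉S z≢y pz≡ps py≢ps
        ... | no pz≢ps  | yes py≡ps = C12-sym (C12-outside-across y∉S z∉S (z≢y ∘ sym) py≡ps pz≢ps)

      C12⇔¬both-in-S : s ∈ S → ∀ x y → C12 D x y ⇔ (x ≢ y × ¬ (x ∈ S × y ∈ S))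
      C12⇔¬both-in-S s∈S x y =
        mk⇔ (λ C12xy → proj₁ C12xy , λ (x∈S , y∈S) → stable x y x∈S y∈S C12xy) (uncurry C12-off-S)
        where
        C12-off-S : x ≢ y → ¬ (x ∈ S × y ∈ S) → C12 D x y
        C12-off-S x≢y ¬both with x ∈? S | y ∈? S
        ... | yes x∈S | yes y∈S = ⊥-elim (¬both (x∈S , y∈S))
        ... | yes x∈S | no  y∉S = C12-sym (C12-outside-inside x∈S y∉S)
        ... | no  x∉S | yes y∈S = C12-outside-inside y∈S x∉S
        ... | no  x∉S | no  y∉S = C12-outside-outside s∈S x∉S y∉S x≢y

    module Alternating4Cycle {a b c d} (cycle : IsAlternating4Cycle a b c d)
                             (S⇔abcd : ∀ y → y ∈ S ⇔ y ∈ₗ a ∷ b ∷ c ∷ d ∷ []) where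
      open IsAlternating4Cycle cycle

      a≢c : a ≢ c
      a≢c refl = arc-asym a→b b→c

      b≢d : b ≢ d
      b≢d refl = arc-asym b→c c→d

      pa≢pb : part a ≢ part b
      pa≢pb = arc⇒part≢ a→b

      ∣S∣≡4 : ∣ S ∣ ≡ 4
      ∣S∣≡4 = ∣p∣≡length S _ abcd-unique S⇔abcd
        where
        abcd-unique : Unique (a ∷ b ∷ c ∷ d ∷ [])
        abcd-unique = (arc⇒≢ a→b ∷ a≢c ∷ arc⇒≢ d→a ∘ sym ∷ [])
                    ∷ (arc⇒≢ b→c ∷ b≢d ∷ [])
                    ∷ (arc⇒≢ c→d ∷ [])
                    ∷ []
                    ∷ []

      abcd⊆S : All (_∈ S) (a ∷ b ∷ c ∷ d ∷ [])
      abcd⊆S = All.tabulate (Equivalence.from (S⇔abcd _))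

      a∈S : a ∈ S
      a∈S = All.lookup abcd⊆S (Any.here refl)

      b∈S : b ∈ S
      b∈S = All.lookup abcd⊆S (Any.there (Any.here refl))

      c∈S : c ∈ S
      c∈S = All.lookup abcd⊆S (Any.there (Any.there (Any.here refl)))

      d∈S : d ∈ S
      d∈S = All.lookup abcd⊆S (Any.there (Any.there (Any.there (Any.here refl))))

      S-cases : (P : Fin n → Set) → P a → P b → P c → P d → ∀ {y} → y ∈ S → P y
      S-cases P Pa Pb Pc Pd = All.lookup {P = P} (Pa ∷ Pb ∷ Pc ∷ Pd ∷ []) ∘ Equivalence.to (S⇔abcd _)

      returns : s ∈ S → ReturnPath s
      returns = S-cases ReturnPath
        (return-path b∈S c∈S a≢c a→b b→c part-c)
        (return-path c∈S d∈S b≢d b→c c→d part-d)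
        (return-path d∈S a∈S (a≢c ∘ sym) c→d d→a (sym part-c))
        (return-path a∈S b∈S (b≢d ∘ sym) d→a a→b (sym part-d))

      in-part-of-a : y ∈ S → part y ≡ part a → y ≡ a ⊎ y ≡ c
      in-part-of-a = S-cases (λ y → part y ≡ part a → y ≡ a ⊎ y ≡ c)
        (λ _ → inj₁ refl)
        (λ pb≡pa → ⊥-elim (pa≢pb (sym pb≡pa)))
        (λ _ → inj₂ refl)
        (λ pd≡pa → ⊥-elim (pa≢pb (trans (sym pd≡pa) part-d)))

      in-part-of-b : y ∈ S → part y ≡ part b → y ≡ b ⊎ y ≡ d
      in-part-of-b = S-cases (λ y → part y ≡ part b → y ≡ b ⊎ y ≡ d)
        (λ pa≡pb → ⊥-elim (pa≢pb pa≡pb))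
        (λ _ → inj₁ refl)
        (λ pc≡pb → ⊥-elim (pa≢pb (trans (sym part-c) pc≡pb)))
        (λ _ → inj₂ refl)

      S⊆part-a∪part-b : y ∈ S → part y ≡ part a ⊎ part y ≡ part b
      S⊆part-a∪part-b = S-cases (λ y → part y ≡ part a ⊎ part y ≡ part b)
        (inj₁ refl) (inj₂ refl) (inj₁ part-c) (inj₂ part-d)

      two-parts-meeting-S-twice : ∃[ i ] ∃[ j ] (i ≢ j × ∣ S ∩ partSet part i ∣ ≡ 2 × ∣ S ∩ partSet part j ∣ ≡ 2)
      two-parts-meeting-S-twice = part a , part b , pa≢pb ,
        ∣S∩partSet∣≡2 a∈S c∈S a≢c part-c in-part-of-a , ∣S∩partSet∣≡2 b∈S d∈S b≢d part-d in-part-of-b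

      5≤n : 5 ≤ n
      5≤n =
        let (t , t≢pa , t≢pb) = ∃-avoiding₂ three≤k (part a) (part b)
            (z , pz≡t) = nonempty t
            z∉S : z ∉ S
            z∉S z∈S = [ t≢pa ∘ trans (sym pz≡t) , t≢pb ∘ trans (sym pz≡t) ]′ (S⊆part-a∪part-b z∈S)
        in subst₂ _<_ ∣S∣≡4 (∣⊤∣≡n n) (p⊂q⇒∣p∣<∣q∣ ((λ _ → ∈⊤) , z , ∈⊤ , z∉S))

      C12≅KnMinusK4 : C12 D ≅G KnMinusK4 n
      C12≅KnMinusK4 = ≅KnMinusK4 (C12 D) S ∣S∣≡4 (Returning.C12⇔¬both-in-S returns a∈S)

    module FromArc (no-sink : ∀ v → ¬ IsSink D v) {u v} (u∈S : u ∈ S) (v∈S : v ∈ S) (u→v : D u v) where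

      into-u : y ∈ S → y ≢ v → part y ≢ part u → D y u
      into-u y∈S y≢v py≢pu with arc-or-arc py≢pu
      ... | inj₁ y→u = y→u
      ... | inj₂ u→y = ⊥-elim (y≢v (out-neighbour-unique no-sink u∈S y∈S v∈S u→y u→v))

      out-of-v : y ∈ S → y ≢ u → part y ≢ part v → D v y
      out-of-v y∈S y≢u py≢pv with arc-or-arc py≢pv
      ... | inj₁ y→v = ⊥-elim (y≢u (in-neighbour-unique y∈S u∈S y→v u→v))
      ... | inj₂ v→y = v→y

      -- If u has no in-neighbour in S besides v, the p found here is an arbitrary vertex; likewise q.
      S-outside-part-u : ∃[ p ] (∀ {y} → y ∈ S → part y ≢ part u → y ≡ v ⊎ y ≡ p)
      S-outside-part-u =
        let (p , is-p) = at-most-one⇒∃-cover (λ y → y ∈? S ×-dec ¬? (y ≟ v) ×-dec ¬? (part y ≟ part u))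
                           (λ (x∈S , x≢v , px≢pu) (y∈S , y≢v , py≢pu) →
                              in-neighbour-unique x∈S y∈S (into-u x∈S x≢v px≢pu) (into-u y∈S y≢v py≢pu))
                           u
        in p , λ {y} y∈S py≢pu → Sum.map₂ (λ y≢v → is-p (y∈S , y≢v , py≢pu)) (toSum (y ≟ v))

      S-outside-part-v : ∃[ q ] (∀ {y} → y ∈ S → part y ≢ part v → y ≡ u ⊎ y ≡ q)
      S-outside-part-v =
        let (q , is-q) = at-most-one⇒∃-cover (λ y → y ∈? S ×-dec ¬? (y ≟ u) ×-dec ¬? (part y ≟ part v))
                           (λ (x∈S , x≢u , px≢pv) (y∈S , y≢u , py≢pv) →
                              out-neighbour-unique no-sink v∈S x∈S y∈S
                                (out-of-v x∈S x≢u px≢pv) (out-of-v y∈S y≢u py≢pv))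
                           u
        in q , λ {y} y∈S py≢pv → Sum.map₂ (λ y≢u → is-q (y∈S , y≢u , py≢pv)) (toSum (y ≟ u))

      module Cover {p q : Fin n} (outside-part-u : ∀ {y} → y ∈ S → part y ≢ part u → y ≡ v ⊎ y ≡ p)
                                   (outside-part-v : ∀ {y} → y ∈ S → part y ≢ part v → y ≡ u ⊎ y ≡ q) where

        S⊆uvqp : S ⊆ₗ u ∷ v ∷ q ∷ p ∷ []
        S⊆uvqp {y} y∈S with part y ≟ part u
        ... | no py≢pu = [ Any.there ∘ Any.here , Any.there ∘ Any.there ∘ Any.there ∘ Any.here ]′
                           (outside-part-u y∈S py≢pu)
        ... | yes py≡pu = [ Any.here , Any.there ∘ Any.there ∘ Any.here ]′
                           (outside-part-v y∈S λ py≡pv → arc⇒part≢ u→v (trans (sym py≡pu) py≡pv))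

        ∣S∣≤4 : ∣ S ∣ ≤ 4
        ∣S∣≤4 = ∣p∣≤length S _ S⊆uvqp

        alternating-cycle : Unique (u ∷ v ∷ q ∷ p ∷ []) → All (_∈ S) (u ∷ v ∷ q ∷ p ∷ []) →
                            IsAlternating4Cycle u v q p
        alternating-cycle ((_ ∷ u≢q ∷ u≢p ∷ []) ∷ (v≢q ∷ v≢p ∷ []) ∷ (q≢p ∷ []) ∷ [] ∷ [])
                          (_ ∷ _ ∷ q∈S ∷ p∈S ∷ []) =
          record { a→b = u→v ; b→c = v→q ; c→d = q→p ; d→a = p→u ; part-c = part-q ; part-d = part-p }
          where
          part-q : part q ≡ part u
          part-q = decidable-stable (part q ≟ part u) λ pq≢pu →
            [ v≢q ∘ sym , q≢p ]′ (outside-part-u q∈S pq≢pu)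

          part-p : part p ≡ part v
          part-p = decidable-stable (part p ≟ part v) λ pp≢pv →
            [ u≢p ∘ sym , q≢p ∘ sym ]′ (outside-part-v p∈S pp≢pv)

          v→q : D v q
          v→q = out-of-v q∈S (u≢q ∘ sym) λ pq≡pv → arc⇒part≢ u→v (trans (sym part-q) pq≡pv)

          p→u : D p u
          p→u = into-u p∈S (v≢p ∘ sym) λ pp≡pu → arc⇒part≢ u→v (trans (sym pp≡pu) part-p)

          q→p : D q p
          q→p with arc-or-arc {q} {p} (λ pq≡pp → arc⇒part≢ u→v (trans (sym part-q) (trans pq≡pp part-p)))
          ... | inj₁ q→p = q→p
          ... | inj₂ p→q = ⊥-elim (v≢p (in-neighbour-unique v∈S p∈S v→q p→q))

        size-4⇒alternating-cycle : ∣ S ∣ ≡ 4 →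
                                   IsAlternating4Cycle u v q p × (∀ y → y ∈ S ⇔ y ∈ₗ u ∷ v ∷ q ∷ p ∷ [])
        size-4⇒alternating-cycle ∣S∣≡4 =
          let (uvqp-unique , uvqp⊆S) = tight-cover⇒distinct-members S _ S⊆uvqp ∣S∣≡4
          in alternating-cycle uvqp-unique uvqp⊆S , λ y → mk⇔ S⊆uvqp (All.lookup uvqp⊆S)

theorem3p8 : (n k : ℕ) (D : Digraph n) (part : Fin n → Fin k)
    → IsMultipartiteTournament D k part
    → Loose D part
    → (∀ v → ¬ IsSink D v)
    → (S : Subset n)
    → AntiCompeting12 D (λ v → v ∈ S)
    → ¬ (∃[ i ] (∀ v → v ∈ S → InPart part i v))
    → ∣ S ∣ ≤ 4
      × (∣ S ∣ ≡ 4
         → (∃[ i ] ∃[ j ] (i ≢ j × ∣ S ∩ partSet part i ∣ ≡ 2 × ∣ S ∩ partSet part j ∣ ≡ 2))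
           × 5 ≤ n
           × (C12 D ≅G KnMinusK4 n))
theorem3p8 n k D part mt _ no-sink S stable ¬in-one-part
  with MultipartiteTournament.crossing-arc mt ¬in-one-part
... | u , v , u∈S , v∈S , u→v = ∣S∣≤4 , λ ∣S∣≡4 →
  let (cycle , S⇔uvqp) = size-4⇒alternating-cycle ∣S∣≡4
      open Alternating4Cycle cycle S⇔uvqp
  in two-parts-meeting-S-twice , 5≤n , C12≅KnMinusK4
  where
  open MultipartiteTournament.StableSet mt stable
  open FromArc no-sink u∈S v∈S u→v
  open Cover (proj₂ S-outside-part-u) (proj₂ S-outside-part-v)
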